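{- Let $a \geq 2$, $b=2$, $c\geq 1$ be integers with $a+b+c=d+e=n$ and $d\geq e$, let $M = n-a$, let $1\leq \mathcal S\leq \lfloor \frac{c+2}{2} \rfloor$, and set $\nu = (a+2,2^{\mathcal S-1},1^{c+2-2\mathcal S})$. If $d < \max(a+\mathcal S,\, c+2-\mathcal S)$ or $d>a+c+2-\mathcal S$, then $\mathcal J_d^{ - }(\nu)=\varnothing$. Consequently $$\operatorname{triple}^{(4)}_{(d, e) \, (a, 2, 1^c) \, \nu} = \sum_{(\delta, i, r) \in \mathcal{J}^{ - }_{d}(\nu) } c_{(a - i, i) \, \delta }^{\nu}\, g_{(M - r, r) \, (b - 1, 1^{c + 1}) \, \delta} = 0.$$
   Context: $c^{\lambda}_{\mu\,\nu}$ are Littlewood--Richardson coefficients; $g_{\lambda\,\mu\,\nu}$ is the Kronecker coefficient (multiplicity of the Specht module $S^\lambda$ in $S^\mu\otimes S^\nu$); tuples with trailing zeros are identified with partitions; $(p,2^k,1^m)$ has one part $p$, $k$ parts $2$, $m$ parts $1$. $\mathbf 1_P$ is $1$ if $P$ holds, else $0$; $\lambda^t$ is the conjugate. $\mathcal N_{\nu\,\delta\,s_1\,s_2}$ is the number of partitions $\kappa$ with $\delta\subseteq\kappa\subseteq\nu$, $\kappa/\delta$ a horizontal strip of size $s_1$, $\nu/\kappa$ a horizontal strip of size $s_2$ (with $\mathcal N_{\nu\,\delta\,-1\,s}=0$). $\operatorname{DH}(L)=\{\lambda\vdash L:\ell(\lambda)\le2\text{ or }(\ell(\lambda)\ge3,\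 \lambda_3\le2)\}$. For a partition $\eta$: $\operatorname{tail}(\eta)=(\eta_3,\dots,\eta_{\ell(\eta)})$ if $\ell(\eta)\ge3$, else empty; $u(\eta),v(\eta)$ count parts of $\operatorname{tail}(\eta)$ equal to $2$, resp. $1$. Type I: $\ell(\eta)\ge2$, $\eta_1-\eta_2\le v(\eta)$; type II: $\ell(\eta)\ge2$, $\eta_1-\eta_2>v(\eta)$. $\mathbf n_3(\eta)=0,\eta_2,u(\eta)+2$; $\mathbf n_4(\eta)=\eta_1,\eta_1,u(\eta)+v(\eta)+2$; $\mathbf d_1(\eta)=0,v(\eta),\eta_1-\eta_2$; $\mathbf d_2(\eta)=0,u(\eta),\eta_2-2$; $\mathbf e^{[p]}_\eta(c)=c+1,c+1,p-1$ (values for $\ell(\eta)=1$, type I, type II). $\Phi(n_3,n_4,d_1,d_2;e,r)=\mathbf 1_{n_3\le r-d_2-1\le n_4}\mathbf 1_{d_1+2d_2<e<d_1+2d_2+3}+\mathbf 1_{n_3\le r-d_2\le n_4}\mathbf 1_{d_1+2d_2\le e\le d_1+2d_2+3}+\mathbf 1_{n_3\le r-d_2+1\le n_4}\mathbf 1_{d_1+2d_2<e<d_1+2d_2+3}-\mathbf 1_{n_3+d_2+d_1=r}\mathbf 1_{d_1+2d_2+1\le e\le d_1+2d_2+2}$; $\Psi(c,r,t,L)=\mathbf 1_{r-1\le c+1\le L-r}\mathbf 1_{c+1=t}+\mathbf 1_{r\le(c+t+2)/2\le L-r}\mathbf 1_{|c+1-t|\le1}$. For $\eta\vdash L$: $\Xi^{[p]}_\eta(0,c)=\mathbf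 1_{\eta=(p,1^{c+1})}$; for $1\le r\le\lfloor L/2\rfloor$, $\Xi^{[p]}_\eta(r,c)=\mathbf 1_{c=0}\mathbf 1_{r=1}$ if $\eta=(L)$; $\mathbf 1_{\eta=(L-r,r)^t}$ if $\eta=(1^L)$; $\Psi(c,r,t,L)$ if $\eta=(h,1^t)\ne(L)$, $h\ge2$, $t\ge1$; $\Phi(\mathbf n_3(\eta),\mathbf n_4(\eta),\mathbf d_1(\eta),\mathbf d_2(\eta);\mathbf e^{[p]}_\eta(c),r)$ if $\eta\in\operatorname{DH}(L)$, $\ell(\eta)\ge2$, $\eta_2\ge2$; $0$ otherwise. $\mathcal I^-(\nu)$: triples $(\delta,i,r)$ with $\delta\vdash M$, $\delta\in\operatorname{DH}(M)$, $0\le i\le\lfloor\frac a2\rfloor$, $0\le r\le\lfloor\frac M2\rfloor$, $\mathcal N_{\nu\,\delta\,i\,a-i}>\mathcal N_{\nu\,\delta\,i-1\,a-i+1}$, $\Xi^{[b-1]}_\delta(r,c)>0$. $\mathcal J^-_d(\nu)=\{(\delta,i,r)\in\mathcal I^-(\nu):\max(a-i+r,\,i+M-r)\le d\le a+M-i-r\}$. -}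

module Defs where

open import Data.Bool.Base using (Bool; true; false; _∧_; _∨_; not; if_then_else_; T)
open import Data.Nat.Base as ℕ using (ℕ; zero; suc; _+_; _*_; _∸_; _≤_; _<_; _/_; _⊔_; _≡ᵇ_)
open import Data.Integer.Base as ℤ using (ℤ; +_; 0ℤ; ∣_∣)
open import Data.Nat.ListAction using (sum)
open import Data.List.Base using (List; []; _∷_; _++_; length; map; replicate; drop; concatMap; upTo)
open import Data.Product using (_×_)
open import Data.Sum using (_⊎_)
open import Relation.Binary.PropositionalEquality using (_≡_)

-- A canonical partition
-- has weakly decreasing, strictly positive parts.  part λ j is λ_j
-- (1-indexed), and 0 beyond the length (trailing zeros identified).

at : List ℕ → ℕ → ℕ
at []       _       = 0
at (x ∷ _)  zero    = x
at (_ ∷ xs) (suc k) = at xs k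

part : List ℕ → ℕ → ℕ
part λ' j = at λ' (j ∸ 1)

-- weakly decreasing (zeros allowed: "padded" partition)
isDecr : List ℕ → Bool
isDecr []           = true
isDecr (x ∷ [])     = true
isDecr (x ∷ y ∷ xs) = (y ℕ.≤ᵇ x) ∧ isDecr (y ∷ xs)

isPart : List ℕ → Bool
isPart []           = true
isPart (x ∷ [])     = 1 ℕ.≤ᵇ x
isPart (x ∷ y ∷ xs) = (y ℕ.≤ᵇ x) ∧ isPart (y ∷ xs)

_⊢_ : List ℕ → ℕ → Set
λ' ⊢ L = T (isPart λ') × sum λ' ≡ L

DH : ℕ → List ℕ → Set
DH L λ' = λ' ⊢ L × (length λ' ≤ 2 ⊎ (3 ≤ length λ' × part λ' 3 ≤ 2))

DHᵇ : ℕ → List ℕ → Bool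
DHᵇ L λ' = isPart λ' ∧ (sum λ' ≡ᵇ L)
           ∧ ((length λ' ℕ.≤ᵇ 2) ∨ ((3 ℕ.≤ᵇ length λ') ∧ (part λ' 3 ℕ.≤ᵇ 2)))

count : {A : Set} → (A → Bool) → List A → ℕ
count f []       = 0
count f (x ∷ xs) = if f x then suc (count f xs) else count f xs

allTo : ℕ → (ℕ → Bool) → Bool
allTo zero    f = true
allTo (suc B) f = f (suc B) ∧ allTo B f

eqList : List ℕ → List ℕ → Bool
eqList []       []       = true
eqList (x ∷ xs) (y ∷ ys) = (x ≡ᵇ y) ∧ eqList xs ys
eqList _        _        = false

lists : ℕ → ℕ → List (List ℕ)
lists zero    m = [] ∷ []
lists (suc k) m = concatMap (λ x → map (x ∷_) (lists k m)) (upTo (suc m))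

-- μ ⊆ λ and λ/μ is a horizontal strip (λ_{j+1} ≤ μ_j for all j) of size s
hstrip : List ℕ → List ℕ → ℕ → Bool
hstrip λ' μ s =
  allTo B (λ j → (part μ j ℕ.≤ᵇ part λ' j) ∧ (part λ' (suc j) ℕ.≤ᵇ part μ j))
  ∧ (sum λ' ≡ᵇ sum μ + s)
  where B = length λ' + length μ + 1

-- 𝒩_{ν δ s₁ s₂}: number of partitions κ with δ ⊆ κ ⊆ ν, κ/δ horizontal
-- strip of size s₁, ν/κ horizontal strip of size s₂.  Since κ ⊆ ν, κ is
-- enumerated as a weakly decreasing list of length ℓ(ν) (padded with
-- zeros) with entries ≤ ν₁; distinct padded lists are distinct partitions.
𝒩 : List ℕ → List ℕ → ℕ → ℕ → ℕ
𝒩 ν δ s₁ s₂ =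
  count (λ κ → isDecr κ ∧ hstrip κ δ s₁ ∧ hstrip ν κ s₂)
        (lists (length ν) (part ν 1))

-- 𝒩_{ν δ (i-1) s}, with the convention 𝒩_{ν δ (-1) s} = 0
𝒩pred : List ℕ → List ℕ → ℕ → ℕ → ℕ
𝒩pred ν δ zero    s = 0
𝒩pred ν δ (suc j) s = 𝒩 ν δ j s

tail : List ℕ → List ℕ
tail η = drop 2 η

u v : List ℕ → ℕ
u η = count (λ x → x ≡ᵇ 2) (tail η)
v η = count (λ x → x ≡ᵇ 1) (tail η)

typeI : List ℕ → Bool
typeI η = (2 ℕ.≤ᵇ length η) ∧ ((part η 1 ∸ part η 2) ℕ.≤ᵇ v η)

byType : List ℕ → ℕ → ℕ → ℕ → ℕ
byType η x y z = if length η ≡ᵇ 1 then x else (if typeI η then y else z)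

n₃ n₄ d₁ d₂ : List ℕ → ℕ
n₃ η = byType η 0 (part η 2) (u η + 2)
n₄ η = byType η (part η 1) (part η 1) (u η + v η + 2)
d₁ η = byType η 0 (v η) (part η 1 ∸ part η 2)
d₂ η = byType η 0 (u η) (part η 2 ∸ 2)

e[_] : ℕ → List ℕ → ℕ → ℕ
e[ p ] η c = byType η (c + 1) (c + 1) (p ∸ 1)

𝟏 : Bool → ℤ
𝟏 true  = ℤ.+ 1
𝟏 false = 0ℤ

_≤ᶻ_ : ℤ → ℤ → Bool
x ≤ᶻ y = x ℤ.≤ᵇ y

_<ᶻ_ : ℤ → ℤ → Bool
x <ᶻ y = (x ℤ.+ ℤ.+ 1) ℤ.≤ᵇ y

_=ᶻ_ : ℤ → ℤ → Bool
x =ᶻ y = (x ℤ.≤ᵇ y) ∧ (y ℤ.≤ᵇ x)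

Φ : (n₃ n₄ d₁ d₂ e r : ℤ) → ℤ
Φ n₃ n₄ d₁ d₂ e r =
      𝟏 ((n₃ ≤ᶻ (r ℤ.- d₂ ℤ.- ℤ.+ 1)) ∧ ((r ℤ.- d₂ ℤ.- ℤ.+ 1) ≤ᶻ n₄))
        ℤ.* 𝟏 ((D <ᶻ e) ∧ (e <ᶻ (D ℤ.+ ℤ.+ 3)))
  ℤ.+ 𝟏 ((n₃ ≤ᶻ (r ℤ.- d₂)) ∧ ((r ℤ.- d₂) ≤ᶻ n₄))
        ℤ.* 𝟏 ((D ≤ᶻ e) ∧ (e ≤ᶻ (D ℤ.+ ℤ.+ 3)))
  ℤ.+ 𝟏 ((n₃ ≤ᶻ (r ℤ.- d₂ ℤ.+ ℤ.+ 1)) ∧ ((r ℤ.- d₂ ℤ.+ ℤ.+ 1) ≤ᶻ n₄))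
        ℤ.* 𝟏 ((D <ᶻ e) ∧ (e <ᶻ (D ℤ.+ ℤ.+ 3)))
  ℤ.- 𝟏 ((n₃ ℤ.+ d₂ ℤ.+ d₁) =ᶻ r)
        ℤ.* 𝟏 (((D ℤ.+ ℤ.+ 1) ≤ᶻ e) ∧ (e ≤ᶻ (D ℤ.+ ℤ.+ 2)))
  where D = d₁ ℤ.+ ℤ.+ 2 ℤ.* d₂

-- Ψ(c,r,t,L); the condition r ≤ (c+t+2)/2 ≤ L−r is stated exactly
-- (rational division) as 2r ≤ c+t+2 ≤ 2(L−r).
Ψ : (c r t L : ℤ) → ℤ
Ψ c r t L =
      𝟏 (((r ℤ.- ℤ.+ 1) ≤ᶻ (c ℤ.+ ℤ.+ 1)) ∧ ((c ℤ.+ ℤ.+ 1) ≤ᶻ (L ℤ.- r)))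
        ℤ.* 𝟏 ((c ℤ.+ ℤ.+ 1) =ᶻ t)
  ℤ.+ 𝟏 (((ℤ.+ 2 ℤ.* r) ≤ᶻ (c ℤ.+ t ℤ.+ ℤ.+ 2))
         ∧ ((c ℤ.+ t ℤ.+ ℤ.+ 2) ≤ᶻ (ℤ.+ 2 ℤ.* (L ℤ.- r))))
        ℤ.* 𝟏 (∣ c ℤ.+ ℤ.+ 1 ℤ.- t ∣ ℕ.≤ᵇ 1)

conj : List ℕ → List ℕ
conj λ' = map (λ j → count (λ x → j ℕ.≤ᵇ x) λ') (map suc (upTo (part λ' 1)))

isHook : List ℕ → Bool
isHook []       = false
isHook (h ∷ xs) = (2 ℕ.≤ᵇ h) ∧ (1 ℕ.≤ᵇ length xs)
                  ∧ eqList xs (replicate (length xs) 1)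

Ξ[_] : ℕ → List ℕ → ℕ → ℕ → ℤ
Ξ[ p ] η zero c = 𝟏 (eqList η (p ∷ replicate (c + 1) 1))
Ξ[ p ] η (suc r') c =
  if not (suc r' ℕ.≤ᵇ L / 2) then 0ℤ else
  (if eqList η (L ∷ []) then 𝟏 ((c ≡ᵇ 0) ∧ (r ≡ᵇ 1)) else
  (if eqList η (replicate L 1) then 𝟏 (eqList η (conj ((L ∸ r) ∷ r ∷ []))) else
  (if isHook η then Ψ (ℤ.+ c) (ℤ.+ r) (ℤ.+ (length η ∸ 1)) (ℤ.+ L) else
  (if DHᵇ L η ∧ (2 ℕ.≤ᵇ length η) ∧ (2 ℕ.≤ᵇ part η 2)
     then Φ (ℤ.+ n₃ η) (ℤ.+ n₄ η) (ℤ.+ d₁ η) (ℤ.+ d₂ η) (ℤ.+ e[ p ] η c) (ℤ.+ r)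
     else 0ℤ))))
  where
    L = sum η
    r = suc r'

ℐ⁻ : (ν : List ℕ) (a b c M : ℕ) (δ : List ℕ) (i r : ℕ) → Set
ℐ⁻ ν a b c M δ i r =
  DH M δ × i ≤ a / 2 × r ≤ M / 2
  × 𝒩pred ν δ i (a ∸ i + 1) < 𝒩 ν δ i (a ∸ i)
  × 0ℤ ℤ.< Ξ[ b ∸ 1 ] δ r c

𝒥⁻ : (d : ℕ) (ν : List ℕ) (a b c M : ℕ) (δ : List ℕ) (i r : ℕ) → Set
𝒥⁻ d ν a b c M δ i r =
  ℐ⁻ ν a b c M δ i r
  × (a ∸ i + r) ⊔ (i + M ∸ r) ≤ d × d ≤ a + M ∸ i ∸ r

νₐ : (a c S : ℕ) → List ℕ
νₐ a c S = (a + 2) ∷ replicate (S ∸ 1) 2 ++ replicate (c + 2 ∸ 2 * S) 1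

{-# OPTIONS --safe #-}
-- For b = 2 the Kronecker factor is Ξ^{[1]}, and for δ ⊢ c + 2 with c ≥ 1 this is positive only
-- when δ is the column (1^{c+2}) or δ = (2, w) with r the number of parts 2 of δ: the hook
-- and the generic (Φ) cases both force δ₁ = 2.  A triple of ℐ⁻(ν) has δ ⊆ ν.  The column is
-- longer than ν; otherwise δ ⊆ ν and |ν| − |δ| = a force δ = (2, ν₂, ν₃, …), whence r = 𝒮.
-- Then ν/δ is one row, every 𝒩_{ν δ s₁ s₂} is at most 1, and 𝒩_{ν δ (i−1) (a−i+1)} ≥ 1 for
-- i ≥ 1, so the strict inequality of ℐ⁻ forces i = 0.  With i = 0 and r = 𝒮 the window of 𝒥⁻_d
-- is exactly max(a + 𝒮, c + 2 − 𝒮) ≤ d ≤ a + c + 2 − 𝒮.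
module Submission where

open import Defs
open import Data.Nat.Base using (ℕ; _+_; _∸_; _≤_; _<_; _/_; _⊔_)
open import Data.List.Base using (List)
open import Data.Sum using (_⊎_)
open import Relation.Binary.PropositionalEquality using (_≡_)
open import Relation.Nullary using (¬_)

open import Data.Bool.Base using (Bool; true; false; _∧_; T)
open import Data.Bool.Properties using (T-∧; T-≡)
open import Data.Empty using (⊥-elim)
open import Data.Integer.Base as ℤ using (ℤ; +_; 0ℤ; ∣_∣)
import Data.Integer.Properties as ℤ
open import Data.List.Base using ([]; _∷_; _++_; replicate; length; map; upTo)
open import Data.List.Membership.Propositional using (_∈_; lose)
open import Data.List.Membership.Propositional.Properties
  using (∈-map⁺; ∈-map⁻; ∈-concatMap⁺; ∈-concatMap⁻; ∈-upTo⁺)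
open import Data.List.Properties using (∷-injectiveˡ; ∷-injectiveʳ; length-replicate)
open import Data.List.Relation.Binary.Disjoint.Propositional using (Disjoint)
open import Data.List.Relation.Unary.All as All using (All; []; _∷_)
import Data.List.Relation.Unary.All.Properties as All
import Data.List.Relation.Unary.AllPairs as AllPairs
import Data.List.Relation.Unary.AllPairs.Properties as AllPairs
import Data.List.Relation.Unary.Any as Any
open import Data.List.Relation.Unary.Any using (here; there)
open import Data.List.Relation.Unary.Unique.Propositional using (Unique)
import Data.List.Relation.Unary.Unique.Propositional.Properties as Unique
open import Data.Nat.Base using (zero; suc; z≤n; s≤s; _*_; _≤ᵇ_; _≡ᵇ_)
open import Data.Nat.DivMod using (m/n≤m; m/n*n≤m)
open import Data.Nat.ListAction using (sum)
open import Data.Nat.ListAction.Properties using (sum-++)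
open import Data.Nat.Properties
open import Data.Nat.Tactic.RingSolver using (solve-∀)
open import Data.Product using (_×_; _,_; proj₁; proj₂; map₂; ∃-syntax)
open import Data.Sum using (inj₁; inj₂; [_,_])
import Data.Sum as Sum
open import Data.Unit.Base using (tt)
open import Function.Base using (_∘_)
open import Function.Bundles using (Equivalence)
open import Relation.Binary.PropositionalEquality
  using (_≢_; refl; sym; trans; cong; cong₂; subst; subst₂; module ≡-Reasoning)
open import Relation.Nullary using (yes; no)

T-∧⁻ : ∀ x {y} → T (x ∧ y) → T x × T y
T-∧⁻ x = Equivalence.to (T-∧ {x})

T-∧⁺ : ∀ x {y} → T x → T y → T (x ∧ y)
T-∧⁺ x tx ty = Equivalence.from (T-∧ {x}) (tx , ty)

𝟏*𝟏≡𝟏∧ : ∀ x y → 𝟏 x ℤ.* 𝟏 y ≡ 𝟏 (x ∧ y)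
𝟏*𝟏≡𝟏∧ true  true  = refl
𝟏*𝟏≡𝟏∧ true  false = refl
𝟏*𝟏≡𝟏∧ false _     = refl

𝟏-pos : ∀ x → 0ℤ ℤ.< 𝟏 x → T x
𝟏-pos true  _          = tt
𝟏-pos false (ℤ.+<+ ())

𝟏+𝟏-pos : ∀ x y → 0ℤ ℤ.< 𝟏 x ℤ.+ 𝟏 y → T x ⊎ T y
𝟏+𝟏-pos true  _     _          = inj₁ tt
𝟏+𝟏-pos false true  _          = inj₂ tt
𝟏+𝟏-pos false false (ℤ.+<+ ())

𝟏+𝟏+𝟏-𝟏-pos : ∀ x y z w → 0ℤ ℤ.< 𝟏 x ℤ.+ 𝟏 y ℤ.+ 𝟏 z ℤ.- 𝟏 w → T x ⊎ T y ⊎ T z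
𝟏+𝟏+𝟏-𝟏-pos true  _     _     _     _          = inj₁ tt
𝟏+𝟏+𝟏-𝟏-pos false true  _     _     _          = inj₂ (inj₁ tt)
𝟏+𝟏+𝟏-𝟏-pos false false true  _     _          = inj₂ (inj₂ tt)
𝟏+𝟏+𝟏-𝟏-pos false false false false (ℤ.+<+ ())

𝟏*𝟏+𝟏*𝟏-pos : ∀ x x′ y y′ → 0ℤ ℤ.< 𝟏 x ℤ.* 𝟏 x′ ℤ.+ 𝟏 y ℤ.* 𝟏 y′ →
               (T x × T x′) ⊎ (T y × T y′)
𝟏*𝟏+𝟏*𝟏-pos x x′ y y′ p rewrite 𝟏*𝟏≡𝟏∧ x x′ | 𝟏*𝟏≡𝟏∧ y y′ =
  Sum.map (T-∧⁻ x) (T-∧⁻ y) (𝟏+𝟏-pos _ _ p)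

𝟏*𝟏+𝟏*𝟏+𝟏*𝟏-𝟏*𝟏-pos : ∀ x x′ y y′ z z′ w w′ →
  0ℤ ℤ.< 𝟏 x ℤ.* 𝟏 x′ ℤ.+ 𝟏 y ℤ.* 𝟏 y′ ℤ.+ 𝟏 z ℤ.* 𝟏 z′ ℤ.- 𝟏 w ℤ.* 𝟏 w′ →
  (T x × T x′) ⊎ (T y × T y′) ⊎ (T z × T z′)
𝟏*𝟏+𝟏*𝟏+𝟏*𝟏-𝟏*𝟏-pos x x′ y y′ z z′ w w′ p
  rewrite 𝟏*𝟏≡𝟏∧ x x′ | 𝟏*𝟏≡𝟏∧ y y′ | 𝟏*𝟏≡𝟏∧ z z′ | 𝟏*𝟏≡𝟏∧ w w′ =
  Sum.map (T-∧⁻ x) (Sum.map (T-∧⁻ y) (T-∧⁻ z)) (𝟏+𝟏+𝟏-𝟏-pos _ _ _ _ p)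

i-j+j≡i : ∀ i j → i ℤ.- j ℤ.+ j ≡ i
i-j+j≡i i j = begin
  i ℤ.- j ℤ.+ j       ≡⟨ ℤ.+-assoc i (ℤ.- j) j ⟩
  i ℤ.+ (ℤ.- j ℤ.+ j) ≡⟨ cong (λ k → i ℤ.+ k) (ℤ.+-inverseˡ j) ⟩
  i ℤ.+ 0ℤ            ≡⟨ ℤ.+-identityʳ i ⟩
  i                   ∎
  where open ≡-Reasoning

≤ᶻ⇒≤ : ∀ {i j m n} → i ≡ + m → j ≡ + n → T (i ≤ᶻ j) → m ≤ n
≤ᶻ⇒≤ refl refl t = ≤ᵇ⇒≤ _ _ t

m≤ᶻn-o⇒m+o≤n : ∀ m n o → T ((+ m) ≤ᶻ (+ n ℤ.- + o)) → m + o ≤ n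
m≤ᶻn-o⇒m+o≤n m n o t =
  ℤ.drop‿+≤+ (subst₂ ℤ._≤_ refl (i-j+j≡i (+ n) (+ o)) (ℤ.+-monoˡ-≤ (+ o) (ℤ.≤ᵇ⇒≤ {+ m} {+ n ℤ.- + o} t)))

m-o≤ᶻn⇒m≤n+o : ∀ m n o → T ((+ m ℤ.- + o) ≤ᶻ (+ n)) → m ≤ n + o
m-o≤ᶻn⇒m≤n+o m n o t =
  ℤ.drop‿+≤+ (subst₂ ℤ._≤_ (i-j+j≡i (+ m) (+ o)) refl (ℤ.+-monoˡ-≤ (+ o) (ℤ.≤ᵇ⇒≤ {+ m ℤ.- + o} {+ n} t)))

Φ-pos : ∀ n₃ n₄ d₁ d₂ e r → 0ℤ ℤ.< Φ (+ n₃) (+ n₄) (+ d₁) (+ d₂) (+ e) (+ r) →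
        d₁ + 2 * d₂ ≤ e × e ≤ d₁ + 2 * d₂ + 3
        × (e ≡ d₁ + 2 * d₂ + 3 → n₃ + d₂ ≤ r × r ≤ n₄ + d₂)
Φ-pos n₃ n₄ d₁ d₂ e r p =
  [ (λ (_ , o) → inside o)
  , [ (λ (w , c) → let c₁ , c₂ = closed c in c₁ , c₂ , λ _ → middle w) , (λ (_ , o) → inside o) ] ]
  (𝟏*𝟏+𝟏*𝟏+𝟏*𝟏-𝟏*𝟏-pos (window (r⁻ ℤ.- + 1)) inner (window r⁻) closed-e (window (r⁻ ℤ.+ + 1)) inner
              ((+ n₃ ℤ.+ + d₂ ℤ.+ + d₁) =ᶻ (+ r)) (((D ℤ.+ + 1) ≤ᶻ (+ e)) ∧ ((+ e) ≤ᶻ (D ℤ.+ + 2))) p)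
  where
    D  = + d₁ ℤ.+ + 2 ℤ.* + d₂
    D′ = d₁ + 2 * d₂
    r⁻ = + r ℤ.- + d₂
    window : ℤ → Bool
    window k = ((+ n₃) ≤ᶻ k) ∧ (k ≤ᶻ (+ n₄))
    inner    = (D <ᶻ (+ e)) ∧ ((+ e) <ᶻ (D ℤ.+ + 3))
    closed-e = (D ≤ᶻ (+ e)) ∧ ((+ e) ≤ᶻ (D ℤ.+ + 3))
    D≡ : D ≡ + D′
    D≡ = cong (λ k → + d₁ ℤ.+ k) (sym (ℤ.pos-* 2 d₂))
    D+ : ∀ k → D ℤ.+ + k ≡ + (D′ + k)
    D+ k = cong (ℤ._+ + k) D≡
    closed : T closed-e → D′ ≤ e × e ≤ D′ + 3
    closed c = let c₁ , c₂ = T-∧⁻ (D ≤ᶻ (+ e)) c in ≤ᶻ⇒≤ D≡ refl c₁ , ≤ᶻ⇒≤ refl (D+ 3) c₂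
    inside : T inner → D′ ≤ e × e ≤ D′ + 3 × (e ≡ D′ + 3 → n₃ + d₂ ≤ r × r ≤ n₄ + d₂)
    inside o = <⇒≤ D′<e , <⇒≤ e<D′+3 , λ e≡ → ⊥-elim (<-irrefl e≡ e<D′+3)
      where
        o₁ = proj₁ (T-∧⁻ (D <ᶻ (+ e)) o)
        o₂ = proj₂ (T-∧⁻ (D <ᶻ (+ e)) o)
        D′<e : D′ < e
        D′<e = subst₂ _≤_ (+-comm D′ 1) refl (≤ᶻ⇒≤ (D+ 1) refl o₁)
        e<D′+3 : e < D′ + 3
        e<D′+3 = subst₂ _≤_ (+-comm e 1) refl (≤ᶻ⇒≤ refl (D+ 3) o₂)
    middle : T (window r⁻) → n₃ + d₂ ≤ r × r ≤ n₄ + d₂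
    middle w = let w₁ , w₂ = T-∧⁻ ((+ n₃) ≤ᶻ r⁻) w in m≤ᶻn-o⇒m+o≤n n₃ r d₂ w₁ , m-o≤ᶻn⇒m≤n+o r n₄ d₂ w₂

∣m-n∣≤1⇒m≤1+n : ∀ m n → ∣ + m ℤ.- + n ∣ ≤ 1 → m ≤ suc n
∣m-n∣≤1⇒m≤1+n m n h with ≤-total n m
... | inj₂ m≤n = m≤n⇒m≤1+n m≤n
... | inj₁ n≤m = subst₂ _≤_ (m∸n+n≡m n≤m) refl (+-monoˡ-≤ n m∸n≤1)
  where
    m∸n≤1 : m ∸ n ≤ 1
    m∸n≤1 = subst₂ _≤_ (cong ∣_∣ (trans (ℤ.m-n≡m⊖n m n) (ℤ.⊖-≥ n≤m))) refl h

Ψ-pos : ∀ c r t L → r ≤ L → 0ℤ ℤ.< Ψ (+ c) (+ r) (+ t) (+ L) →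
        c + 1 ≡ t ⊎ (c ≤ t × c + t + 2 ≤ 2 * (L ∸ r))
Ψ-pos c r t L r≤L p =
  Sum.map first-summand second-summand (𝟏*𝟏+𝟏*𝟏-pos
    ((((+ r) ℤ.- (+ 1)) ≤ᶻ ((+ c) ℤ.+ (+ 1))) ∧ (((+ c) ℤ.+ (+ 1)) ≤ᶻ ((+ L) ℤ.- (+ r))))
    (((+ c) ℤ.+ (+ 1)) =ᶻ (+ t))
    (((+ 2 ℤ.* (+ r)) ≤ᶻ ((+ c) ℤ.+ (+ t) ℤ.+ (+ 2)))
      ∧ (((+ c) ℤ.+ (+ t) ℤ.+ (+ 2)) ≤ᶻ (+ 2 ℤ.* ((+ L) ℤ.- (+ r)))))
    (∣ (+ c) ℤ.+ (+ 1) ℤ.- (+ t) ∣ ≤ᵇ 1)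
    p)
  where
    first-summand : _ × T (((+ c) ℤ.+ (+ 1)) =ᶻ (+ t)) → c + 1 ≡ t
    first-summand (_ , q) = let q₁ , q₂ = T-∧⁻ (c + 1 ≤ᵇ t) q in ≤-antisym (≤ᵇ⇒≤ _ _ q₁) (≤ᵇ⇒≤ _ _ q₂)
    2[L-r] : + 2 ℤ.* ((+ L) ℤ.- (+ r)) ≡ + (2 * (L ∸ r))
    2[L-r] = trans (cong (+ 2 ℤ.*_) (trans (ℤ.m-n≡m⊖n L r) (ℤ.⊖-≥ r≤L))) (sym (ℤ.pos-* 2 (L ∸ r)))
    second-summand : T (((+ 2 ℤ.* (+ r)) ≤ᶻ ((+ c) ℤ.+ (+ t) ℤ.+ (+ 2)))
                 ∧ (((+ c) ℤ.+ (+ t) ℤ.+ (+ 2)) ≤ᶻ (+ 2 ℤ.* ((+ L) ℤ.- (+ r)))))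
             × T (∣ (+ c) ℤ.+ (+ 1) ℤ.- (+ t) ∣ ≤ᵇ 1)
           → c ≤ t × c + t + 2 ≤ 2 * (L ∸ r)
    second-summand (q , q′) =
      ≤-pred (subst₂ _≤_ (+-comm c 1) refl (∣m-n∣≤1⇒m≤1+n (c + 1) t (≤ᵇ⇒≤ _ 1 q′))) ,
      ≤ᶻ⇒≤ refl 2[L-r] (proj₂ (T-∧⁻ ((+ 2 ℤ.* (+ r)) ≤ᶻ ((+ c) ℤ.+ (+ t) ℤ.+ (+ 2))) q))

≤-+-tight : ∀ {a b x y} → a ≤ x → b ≤ y → x + y ≤ a + b → x ≡ a × y ≡ b
≤-+-tight {a} {b} {x} {y} a≤x b≤y x+y≤a+b =
  ≤-antisym (+-cancelʳ-≤ b x a (≤-trans (+-monoʳ-≤ x b≤y) x+y≤a+b)) a≤x ,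
  ≤-antisym (+-cancelˡ-≤ a y b (≤-trans (+-monoˡ-≤ y a≤x) x+y≤a+b)) b≤y

sum-replicate : ∀ n x → sum (replicate n x) ≡ n * x
sum-replicate zero    x = refl
sum-replicate (suc n) x = cong (λ k → x + k) (sum-replicate n x)

eqList-sound : ∀ xs ys → T (eqList xs ys) → xs ≡ ys
eqList-sound []       []       _ = refl
eqList-sound (x ∷ xs) (y ∷ ys) t =
  let x≡y , xs≡ys = T-∧⁻ (x ≡ᵇ y) t in cong₂ _∷_ (≡ᵇ⇒≡ x y x≡y) (eqList-sound xs ys xs≡ys)

-- u η and v η of Defs are twos and ones of drop 2 η.
twos ones : List ℕ → ℕ
twos = count (_≡ᵇ 2)
ones = count (_≡ᵇ 1)

twos-1ⁿ≡0 : ∀ n → twos (replicate n 1) ≡ 0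
twos-1ⁿ≡0 zero    = refl
twos-1ⁿ≡0 (suc n) = twos-1ⁿ≡0 n

ones+2*twos≤sum : ∀ w → ones w + 2 * twos w ≤ sum w
ones+2*twos≤sum []                      = z≤n
ones+2*twos≤sum (0 ∷ w)                 = ones+2*twos≤sum w
ones+2*twos≤sum (1 ∷ w)                 = s≤s (ones+2*twos≤sum w)
ones+2*twos≤sum (2 ∷ w)                 = begin
  ones w + 2 * suc (twos w)   ≡⟨ shift (ones w) (twos w) ⟩
  2 + (ones w + 2 * twos w)   ≤⟨ +-monoʳ-≤ 2 (ones+2*twos≤sum w) ⟩
  2 + sum w                   ∎
  where
    open ≤-Reasoning
    shift : ∀ o t → o + 2 * suc t ≡ 2 + (o + 2 * t)
    shift = solve-∀
ones+2*twos≤sum (suc (suc (suc x)) ∷ w) = ≤-trans (ones+2*twos≤sum w) (m≤n+m (sum w) _)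

isPart⇒positive : ∀ xs → T (isPart xs) → All (1 ≤_) xs
isPart⇒positive []           _  = []
isPart⇒positive (x ∷ [])     p  = ≤ᵇ⇒≤ 1 x p ∷ []
isPart⇒positive (x ∷ y ∷ xs) p  =
  let y≤x , p′   = T-∧⁻ (y ≤ᵇ x) p
      positive = isPart⇒positive (y ∷ xs) p′
  in ≤-trans (All.head positive) (≤ᵇ⇒≤ y x y≤x) ∷ positive

length≤sum : ∀ {xs} → All (1 ≤_) xs → length xs ≤ sum xs
length≤sum []          = z≤n
length≤sum (1≤x ∷ pos) = +-mono-≤ 1≤x (length≤sum pos)

isDecr-at : ∀ xs → T (isDecr xs) → ∀ k → at xs (suc k) ≤ at xs k
isDecr-at []           _   _       = z≤n
isDecr-at (x ∷ [])     _   _       = z≤n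
isDecr-at (x ∷ y ∷ xs) dec zero    = ≤ᵇ⇒≤ y x (proj₁ (T-∧⁻ (y ≤ᵇ x) dec))
isDecr-at (x ∷ y ∷ xs) dec (suc k) = isDecr-at (y ∷ xs) (proj₂ (T-∧⁻ (y ≤ᵇ x) dec)) k

isDecr-raise : ∀ {x y} R → y ≤ x → T (isDecr (y ∷ R)) → T (isDecr (x ∷ R))
isDecr-raise          []      _   _   = tt
isDecr-raise {x} {y} (z ∷ R) y≤x dec =
  let z≤y , dec′ = T-∧⁻ (z ≤ᵇ y) dec in T-∧⁺ (z ≤ᵇ x) (≤⇒≤ᵇ (≤-trans (≤ᵇ⇒≤ z y z≤y) y≤x)) dec′

isDecr⇒All≤ : ∀ {y} R → T (isDecr (y ∷ R)) → All (_≤ y) R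
isDecr⇒All≤ []      _   = []
isDecr⇒All≤ {y} (z ∷ R) dec =
  let z≤y , dec′ = T-∧⁻ (z ≤ᵇ y) dec in
  ≤ᵇ⇒≤ _ _ z≤y ∷ All.map (λ r≤z → ≤-trans r≤z (≤ᵇ⇒≤ _ _ z≤y)) (isDecr⇒All≤ R dec′)

isDecr-1∷1ᵠ : ∀ q → T (isDecr (1 ∷ replicate q 1))
isDecr-1∷1ᵠ zero    = tt
isDecr-1∷1ᵠ (suc q) = T-∧⁺ (1 ≤ᵇ 1) tt (isDecr-1∷1ᵠ q)

isDecr-2∷2ᵖ1ᵠ : ∀ p q → T (isDecr (2 ∷ replicate p 2 ++ replicate q 1))
isDecr-2∷2ᵖ1ᵠ zero    q = isDecr-raise (replicate q 1) (s≤s z≤n) (isDecr-1∷1ᵠ q)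
isDecr-2∷2ᵖ1ᵠ (suc p) q = T-∧⁺ (2 ≤ᵇ 2) tt (isDecr-2∷2ᵖ1ᵠ p q)

twos-2ᵖ1ᵠ≡p : ∀ p q → twos (replicate p 2 ++ replicate q 1) ≡ p
twos-2ᵖ1ᵠ≡p zero    q = twos-1ⁿ≡0 q
twos-2ᵖ1ᵠ≡p (suc p) q = cong suc (twos-2ᵖ1ᵠ≡p p q)

2ᵖ1ᵠ-positive : ∀ p q → All (1 ≤_) (replicate p 2 ++ replicate q 1)
2ᵖ1ᵠ-positive p q = All.++⁺ (All.replicate⁺ p (s≤s z≤n)) (All.replicate⁺ q ≤-refl)

-- Where Ξ^{[1]} is positive

data Ξ₁-Shape (c r : ℕ) : List ℕ → Set where
  column  : Ξ₁-Shape c r (replicate (c + 2) 1)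
  headTwo : ∀ w → r ≡ twos (2 ∷ w) → Ξ₁-Shape c r (2 ∷ w)

column-shape : ∀ {c r δ} → δ ≡ replicate (c + 2) 1 → Ξ₁-Shape c r δ
column-shape refl = column

Ψ-hook-tight : ∀ {c r h t} → 2 ≤ h → h + t ≡ c + 2 → 1 ≤ r → r ≤ c + 2 →
          0ℤ ℤ.< Ψ (+ c) (+ r) (+ t) (+ (c + 2)) → h ≡ 2 × t ≡ c × r ≡ 1
Ψ-hook-tight {c} {r} {h} {t} 2≤h h+t≡ 1≤r r≤ p =
  [ ⊥-elim ∘ c+1≢t , from-second-summand ] (Ψ-pos c r t (c + 2) r≤ p)
  where
    c+1≢t : c + 1 ≢ t
    c+1≢t c+1≡t = <-irrefl (sym h≡1) 2≤h
      where
        h≡1 : h ≡ 1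
        h≡1 = +-cancelʳ-≡ t h 1 (begin
          h + t         ≡⟨ h+t≡ ⟩
          c + 2         ≡⟨ +-suc c 1 ⟩
          suc (c + 1)   ≡⟨ cong suc c+1≡t ⟩
          1 + t         ∎)
          where open ≡-Reasoning
    from-second-summand : c ≤ t × c + t + 2 ≤ 2 * (c + 2 ∸ r) → h ≡ 2 × t ≡ c × r ≡ 1
    from-second-summand (c≤t , bound) = h≡2 , t≡c , ≤-antisym r≤1 1≤r
      where
        h≡2,t≡c = ≤-+-tight 2≤h c≤t (≤-reflexive (trans h+t≡ (+-comm c 2)))
        h≡2 = proj₁ h≡2,t≡c
        t≡c = proj₂ h≡2,t≡c
        2[c+1]≡c+c+2 : ∀ c → 2 * (c + 1) ≡ c + c + 2
        2[c+1]≡c+c+2 = solve-∀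
        c+1≤c+2∸r : c + 1 ≤ c + 2 ∸ r
        c+1≤c+2∸r = *-cancelˡ-≤ 2 (begin
          2 * (c + 1)      ≡⟨ 2[c+1]≡c+c+2 c ⟩
          c + c + 2        ≡⟨ cong (λ k → c + k + 2) (sym t≡c) ⟩
          c + t + 2        ≤⟨ bound ⟩
          2 * (c + 2 ∸ r)  ∎)
          where open ≤-Reasoning
        r≤1 : r ≤ 1
        r≤1 = +-cancelˡ-≤ (c + 1) r 1 (begin
          c + 1 + r        ≤⟨ m≤o∸n⇒m+n≤o (c + 1) r≤ c+1≤c+2∸r ⟩
          c + 2            ≡⟨ sym (+-assoc c 1 1) ⟩
          c + 1 + 1        ∎)
          where open ≤-Reasoning

Ξ₁-hook : ∀ {c r} δ → T (isHook δ) → sum δ ≡ c + 2 → 1 ≤ r → r ≤ sum δ →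
          0ℤ ℤ.< Ψ (+ c) (+ r) (+ (length δ ∸ 1)) (+ sum δ) → Ξ₁-Shape c r δ
Ξ₁-hook {c} {r} (h ∷ xs) hook sum≡ 1≤r r≤ p =
  shape (Ψ-hook-tight 2≤h h+t≡ 1≤r (subst (r ≤_) sum≡ r≤)
                      (subst (λ L → 0ℤ ℤ.< Ψ (+ c) (+ r) (+ length xs) (+ L)) sum≡ p))
  where
    hook₁ = T-∧⁻ (2 ≤ᵇ h) hook
    2≤h = ≤ᵇ⇒≤ 2 h (proj₁ hook₁)
    xs≡ : xs ≡ replicate (length xs) 1
    xs≡ = eqList-sound xs (replicate (length xs) 1) (proj₂ (T-∧⁻ (1 ≤ᵇ length xs) (proj₂ hook₁)))
    h+t≡ : h + length xs ≡ c + 2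
    h+t≡ = begin
      h + length xs                      ≡⟨ cong (λ k → h + k) (sym (*-identityʳ (length xs))) ⟩
      h + length xs * 1                  ≡⟨ cong (λ k → h + k) (sym (sum-replicate (length xs) 1)) ⟩
      h + sum (replicate (length xs) 1)  ≡⟨ cong (λ k → h + sum k) (sym xs≡) ⟩
      h + sum xs                         ≡⟨ sum≡ ⟩
      c + 2                              ∎
      where open ≡-Reasoning
    shape : h ≡ 2 × length xs ≡ c × r ≡ 1 → Ξ₁-Shape c r (h ∷ xs)
    shape (refl , t≡c , refl) =
      subst (λ ys → Ξ₁-Shape c 1 (2 ∷ ys)) (sym (trans xs≡ (cong (λ n → replicate n 1) t≡c)))
            (headTwo (replicate c 1) (cong suc (sym (twos-1ⁿ≡0 c))))

Φ-typeI-tight : ∀ {c r h g X d₁ d₂} → 2 ≤ g → g ≤ h → h + (g + X) ≡ c + 2 → d₁ + 2 * d₂ ≤ X →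
  d₁ + 2 * d₂ ≤ c + 1 × c + 1 ≤ d₁ + 2 * d₂ + 3 × (c + 1 ≡ d₁ + 2 * d₂ + 3 → g + d₂ ≤ r × r ≤ h + d₂) →
  h ≡ 2 × g ≡ 2 × r ≡ 2 + d₂
Φ-typeI-tight {c} {r} {h} {g} {X} {d₁} {d₂} 2≤g g≤h sum≡ D≤X (_ , c+1≤D+3 , window) =
  h≡2 , g≡2 , ≤-antisym (subst (λ k → r ≤ k + d₂) h≡2 r≤) (subst (λ k → k + d₂ ≤ r) g≡2 ≤r)
  where
    D = d₁ + 2 * d₂
    c+2≤X+4 : c + 2 ≤ X + 4
    c+2≤X+4 = begin
      c + 2        ≡⟨ +-suc c 1 ⟩
      suc (c + 1)  ≤⟨ s≤s c+1≤D+3 ⟩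
      suc (D + 3)  ≡⟨ sym (+-suc D 3) ⟩
      D + 4        ≤⟨ +-monoˡ-≤ 4 D≤X ⟩
      X + 4        ∎
      where open ≤-Reasoning
    h+g≤4 : h + g ≤ 2 + 2
    h+g≤4 = +-cancelʳ-≤ X (h + g) 4 (begin
      h + g + X    ≡⟨ +-assoc h g X ⟩
      h + (g + X)  ≡⟨ sum≡ ⟩
      c + 2        ≤⟨ c+2≤X+4 ⟩
      X + 4        ≡⟨ +-comm X 4 ⟩
      4 + X        ∎)
      where open ≤-Reasoning
    h≡2,g≡2 = ≤-+-tight (≤-trans 2≤g g≤h) 2≤g h+g≤4
    h≡2 = proj₁ h≡2,g≡2
    g≡2 = proj₂ h≡2,g≡2
    D+3≤c+1 : D + 3 ≤ c + 1
    D+3≤c+1 = +-cancelʳ-≤ 1 (D + 3) (c + 1) (begin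
      D + 3 + 1      ≡⟨ +-assoc D 3 1 ⟩
      D + 4          ≤⟨ +-monoˡ-≤ 4 D≤X ⟩
      X + 4          ≡⟨ +-comm X 4 ⟩
      2 + (2 + X)    ≡⟨ cong₂ (λ x y → x + (y + X)) (sym h≡2) (sym g≡2) ⟩
      h + (g + X)    ≡⟨ sum≡ ⟩
      c + 2          ≡⟨ sym (+-assoc c 1 1) ⟩
      c + 1 + 1      ∎)
      where open ≤-Reasoning
    ≤r = proj₁ (window (≤-antisym c+1≤D+3 D+3≤c+1))
    r≤ = proj₂ (window (≤-antisym c+1≤D+3 D+3≤c+1))

Ξ₁-generic : ∀ {c r} δ → T (isPart δ) → sum δ ≡ c + 2 → T ((2 ≤ᵇ length δ) ∧ (2 ≤ᵇ part δ 2)) →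
  0ℤ ℤ.< Φ (+ n₃ δ) (+ n₄ δ) (+ d₁ δ) (+ d₂ δ) (+ e[ 1 ] δ c) (+ r) → Ξ₁-Shape c r δ
Ξ₁-generic {c} {r} (h ∷ g ∷ w) part-δ sum≡ 2≤g p with typeI (h ∷ g ∷ w) in type | p
... | true  | q = shape (Φ-typeI-tight {d₁ = ones w} (≤ᵇ⇒≤ 2 g 2≤g) g≤h sum≡ (ones+2*twos≤sum w)
                                         (Φ-pos g h (ones w) (twos w) (c + 1) r q))
  where
    g≤h = ≤ᵇ⇒≤ g h (proj₁ (T-∧⁻ (g ≤ᵇ h) part-δ))
    shape : h ≡ 2 × g ≡ 2 × r ≡ 2 + twos w → Ξ₁-Shape c r (h ∷ g ∷ w)
    shape (refl , refl , r≡) = headTwo (2 ∷ w) r≡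
... | false | q = ⊥-elim (subst T (trans (cong (_≤ᵇ ones w) (sym h∸g≡0)) type) tt)
  where
    -- For p = 1 the type II value of e is p ∸ 1 = 0, so Φ > 0 forces δ₁ = δ₂: δ is of type I.
    h∸g≡0 : h ∸ g ≡ 0
    h∸g≡0 = n≤0⇒n≡0 (m+n≤o⇒m≤o (h ∸ g) (proj₁ (Φ-pos _ _ (h ∸ g) (g ∸ 2) 0 r q)))

Ξ₁-support : ∀ {c r} δ → 1 ≤ c → δ ⊢ (c + 2) → 0ℤ ℤ.< Ξ[ 1 ] δ r c → Ξ₁-Shape c r δ
Ξ₁-support {c} {zero} δ _ _ p = column-shape (trans (eqList-sound δ _ (𝟏-pos _ p))
                                                    (cong (λ n → replicate n 1) (sym (+-suc c 1))))
Ξ₁-support {suc c} {suc r} δ (s≤s z≤n) (part-δ , sum-δ) p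
  with suc r ≤ᵇ sum δ / 2 in r≤L/2 | eqList δ (sum δ ∷ []) | eqList δ (replicate (sum δ) 1) in col
     | isHook δ in hook | DHᵇ (sum δ) δ ∧ (2 ≤ᵇ length δ) ∧ (2 ≤ᵇ part δ 2) in generic | p
... | false | _     | _     | _     | _     | ℤ.+<+ ()
... | true  | true  | _     | _     | _     | ℤ.+<+ ()   -- δ = (L) contributes only when c = 0
... | true  | false | true  | _     | _     | _ =
  column-shape (trans (eqList-sound δ _ (Equivalence.from T-≡ col)) (cong (λ n → replicate n 1) sum-δ))
... | true  | false | false | true  | _     | q =
  Ξ₁-hook δ (Equivalence.from T-≡ hook) sum-δ (s≤s z≤n)
          (≤-trans (≤ᵇ⇒≤ _ _ (Equivalence.from T-≡ r≤L/2)) (m/n≤m (sum δ) 2)) q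
... | true  | false | false | false | true  | q =
  Ξ₁-generic δ part-δ sum-δ (proj₂ (T-∧⁻ (DHᵇ (sum δ) δ) (Equivalence.from T-≡ generic))) q
... | true  | false | false | false | false | ℤ.+<+ ()

_⊑_ : List ℕ → List ℕ → Set
xs ⊑ ys = ∀ k → at xs k ≤ at ys k

⊑-trans : ∀ {xs ys zs} → xs ⊑ ys → ys ⊑ zs → xs ⊑ zs
⊑-trans xs⊑ys ys⊑zs k = ≤-trans (xs⊑ys k) (ys⊑zs k)

at-beyond : ∀ xs {k} → length xs ≤ k → at xs k ≡ 0
at-beyond []       _         = refl
at-beyond (x ∷ xs) (s≤s len) = at-beyond xs len

⊑-antisym : ∀ {xs ys} → length xs ≡ length ys → xs ⊑ ys → ys ⊑ xs → xs ≡ ys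
⊑-antisym {[]}     {[]}     _   _     _     = refl
⊑-antisym {x ∷ xs} {y ∷ ys} len xs⊑ys ys⊑xs =
  cong₂ _∷_ (≤-antisym (xs⊑ys 0) (ys⊑xs 0))
            (⊑-antisym {xs} {ys} (suc-injective len) (xs⊑ys ∘ suc) (ys⊑xs ∘ suc))

⊑⇒length≤ : ∀ {xs ys} → All (1 ≤_) xs → xs ⊑ ys → length xs ≤ length ys
⊑⇒length≤ {[]}              _            _     = z≤n
⊑⇒length≤ {x ∷ xs} {[]}     (1≤x ∷ _)    xs⊑ys = ⊥-elim (n≮0 (≤-trans 1≤x (xs⊑ys 0)))
⊑⇒length≤ {x ∷ xs} {y ∷ ys} (_ ∷ pos)    xs⊑ys = s≤s (⊑⇒length≤ {xs} {ys} pos (xs⊑ys ∘ suc))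

⊑⇒sum≤ : ∀ {xs ys} → xs ⊑ ys → sum xs ≤ sum ys
⊑⇒sum≤ {[]}              _     = z≤n
⊑⇒sum≤ {x ∷ xs} {[]}     xs⊑ys = +-mono-≤ (xs⊑ys 0) (⊑⇒sum≤ {xs} {[]} (xs⊑ys ∘ suc))
⊑⇒sum≤ {x ∷ xs} {y ∷ ys} xs⊑ys = +-mono-≤ (xs⊑ys 0) (⊑⇒sum≤ {xs} {ys} (xs⊑ys ∘ suc))

⊑∧sum≡⇒≡ : ∀ {xs ys} → All (1 ≤_) xs → All (1 ≤_) ys → xs ⊑ ys → sum xs ≡ sum ys → xs ≡ ys
⊑∧sum≡⇒≡ {[]}     {[]}     _           _           _     _   = refl
⊑∧sum≡⇒≡ {[]}     {y ∷ ys} _           (1≤y ∷ _)   _     sum≡ =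
  ⊥-elim (<-irrefl sum≡ (≤-trans 1≤y (m≤m+n y (sum ys))))
⊑∧sum≡⇒≡ {x ∷ xs} {[]}     (1≤x ∷ _)   _           xs⊑ys _   =
  ⊥-elim (n≮0 (≤-trans 1≤x (xs⊑ys 0)))
⊑∧sum≡⇒≡ {x ∷ xs} {y ∷ ys} (_ ∷ pos-xs) (_ ∷ pos-ys) xs⊑ys sum≡ =
  cong₂ _∷_ x≡y (⊑∧sum≡⇒≡ {xs} {ys} pos-xs pos-ys (xs⊑ys ∘ suc)
                  (+-cancelˡ-≡ x (sum xs) (sum ys) (trans sum≡ (cong (_+ sum ys) (sym x≡y)))))
  where
    y≤x : y ≤ x
    y≤x = +-cancelʳ-≤ (sum ys) y x (subst (_≤ x + sum ys) sum≡ (+-monoʳ-≤ x (⊑⇒sum≤ {xs} {ys} (xs⊑ys ∘ suc))))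
    x≡y : x ≡ y
    x≡y = ≤-antisym (xs⊑ys 0) y≤x

count-pos⇒∃ : ∀ {A : Set} (f : A → Bool) xs → 1 ≤ count f xs → ∃[ x ] T (f x)
count-pos⇒∃ f (x ∷ xs) pos with f x in fx
... | true  = x , Equivalence.from T-≡ fx
... | false = count-pos⇒∃ f xs pos

count-pos : ∀ {A : Set} (f : A → Bool) {x xs} → x ∈ xs → T (f x) → 1 ≤ count f xs
count-pos f {x} {y ∷ xs} x∈ fx with f y in fy
... | true  = s≤s z≤n
count-pos f {x} {y ∷ xs} (here refl) fx | false = ⊥-elim (subst T fy fx)
count-pos f {x} {y ∷ xs} (there x∈) fx | false = count-pos f x∈ fx

count-none : ∀ {A : Set} (f : A → Bool) xs → (∀ {x} → x ∈ xs → ¬ T (f x)) → count f xs ≡ 0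
count-none f []       _    = refl
count-none f (x ∷ xs) none with f x in fx
... | true  = ⊥-elim (none (here refl) (Equivalence.from T-≡ fx))
... | false = count-none f xs (none ∘ there)

count≤1 : ∀ {A : Set} (f : A → Bool) xs → Unique xs →
          (∀ {x y} → x ∈ xs → y ∈ xs → T (f x) → T (f y) → x ≡ y) → count f xs ≤ 1
count≤1 f []       _            _       = z≤n
count≤1 f (x ∷ xs) (x∉xs AllPairs.∷ xs!) functional with f x in fx
... | true  = ≤-reflexive (cong suc (count-none f xs λ y∈ fy →
                All.lookup x∉xs y∈ (functional (here refl) (there y∈) (Equivalence.from T-≡ fx) fy)))
... | false = count≤1 f xs xs! (λ x∈ y∈ → functional (there x∈) (there y∈))

∈-lists⁻ : ∀ k m {l} → l ∈ lists k m → length l ≡ k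
∈-lists⁻ zero    m (here refl) = refl
∈-lists⁻ (suc k) m l∈ with Any.satisfied (∈-concatMap⁻ (λ x → map (x ∷_) (lists k m)) {xs = upTo (suc m)} l∈)
... | x , l∈x∷ with ∈-map⁻ (x ∷_) l∈x∷
... | l′ , l′∈ , refl = cong suc (∈-lists⁻ k m l′∈)

∈-lists⁺ : ∀ m {l} → All (_≤ m) l → l ∈ lists (length l) m
∈-lists⁺ m {[]}    []         = here refl
∈-lists⁺ m {x ∷ l} (x≤m ∷ l≤m) =
  ∈-concatMap⁺ (λ y → map (y ∷_) (lists (length l) m))
               (lose (∈-upTo⁺ (s≤s x≤m)) (∈-map⁺ (x ∷_) (∈-lists⁺ m l≤m)))

lists-unique : ∀ k m → Unique (lists k m)
lists-unique zero    m = [] AllPairs.∷ AllPairs.[]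
lists-unique (suc k) m =
  Unique.concat⁺ (All.map⁺ (All.universal (λ x → Unique.map⁺ ∷-injectiveʳ (lists-unique k m)) (upTo (suc m))))
                 (AllPairs.map⁺ (AllPairs.map disjoint (Unique.upTo⁺ (suc m))))
  where
    disjoint : ∀ {x y} → x ≢ y → Disjoint (map (x ∷_) (lists k m)) (map (y ∷_) (lists k m))
    disjoint x≢y (v∈x∷ , v∈y∷) with ∈-map⁻ _ v∈x∷ | ∈-map⁻ _ v∈y∷
    ... | _ , _ , refl | _ , _ , eq = x≢y (∷-injectiveˡ eq)

allTo-elim : ∀ B f {j} → T (allTo B f) → 1 ≤ j → j ≤ B → T (f j)
allTo-elim zero    f _   (s≤s _) ()
allTo-elim (suc B) f {j} all 1≤j j≤1+B with j ≟ suc B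
... | yes refl = proj₁ (T-∧⁻ (f (suc B)) all)
... | no  j≢   = allTo-elim B f (proj₂ (T-∧⁻ (f (suc B)) all)) 1≤j (≤-pred (≤∧≢⇒< j≤1+B j≢))

allTo-intro : ∀ B f → (∀ j → T (f (suc j))) → T (allTo B f)
allTo-intro zero    f all = tt
allTo-intro (suc B) f all = T-∧⁺ (f (suc B)) (all B) (allTo-intro B f all)

strip-rows : List ℕ → List ℕ → ℕ → Bool
strip-rows outer inner j = (part inner j ≤ᵇ part outer j) ∧ (part outer (suc j) ≤ᵇ part inner j)

strip-bound : List ℕ → List ℕ → ℕ
strip-bound outer inner = length outer + length inner + 1

hstrip⇒rows : ∀ outer inner s → T (hstrip outer inner s) →
              T (allTo (strip-bound outer inner) (strip-rows outer inner))
hstrip⇒rows outer inner s strip =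
  proj₁ (T-∧⁻ (allTo (strip-bound outer inner) (strip-rows outer inner)) strip)

hstrip⇒⊑ : ∀ outer inner s → T (hstrip outer inner s) → inner ⊑ outer
hstrip⇒⊑ outer inner s strip k with k <? length inner
... | yes k<len = ≤ᵇ⇒≤ _ _ (proj₁ (T-∧⁻ (part inner (suc k) ≤ᵇ part outer (suc k)) row))
  where
    row : T (strip-rows outer inner (suc k))
    row = allTo-elim (strip-bound outer inner) (strip-rows outer inner) (hstrip⇒rows outer inner s strip)
                     (s≤s z≤n) (≤-trans k<len (≤-trans (m≤n+m _ (length outer)) (m≤m+n _ 1)))
... | no  k≮len = subst (_≤ at outer k) (sym (at-beyond inner (≮⇒≥ k≮len))) z≤n

hstrip⇒sum : ∀ outer inner s → T (hstrip outer inner s) → sum outer ≡ sum inner + s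
hstrip⇒sum outer inner s strip =
  ≡ᵇ⇒≡ _ _ (proj₂ (T-∧⁻ (allTo (strip-bound outer inner) (strip-rows outer inner)) strip))

hstrip-head : ∀ {x y s} R → x ≡ y + s → T (isDecr (y ∷ R)) → T (hstrip (x ∷ R) (y ∷ R) s)
hstrip-head {y = y} {s} R refl dec =
  T-∧⁺ (allTo (strip-bound (y + s ∷ R) (y ∷ R)) (strip-rows (y + s ∷ R) (y ∷ R)))
       (allTo-intro (strip-bound (y + s ∷ R) (y ∷ R)) (strip-rows (y + s ∷ R) (y ∷ R)) rows)
       (≡⇒≡ᵇ _ _ (y+s+R≡y+R+s y s (sum R)))
  where
    y+s+R≡y+R+s : ∀ y s R → y + s + R ≡ y + R + s
    y+s+R≡y+R+s = solve-∀
    rows : ∀ j → T (strip-rows (y + s ∷ R) (y ∷ R) (suc j))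
    rows zero    = T-∧⁺ (y ≤ᵇ y + s) (≤⇒≤ᵇ (m≤m+n y s)) (≤⇒≤ᵇ (isDecr-at (y ∷ R) dec 0))
    rows (suc j) = T-∧⁺ (at R j ≤ᵇ at R j) (≤⇒≤ᵇ (≤-refl {at R j})) (≤⇒≤ᵇ (isDecr-at (y ∷ R) dec (suc j)))

𝒩-pos⇒⊑ : ∀ ν δ s₁ s₂ → 1 ≤ 𝒩 ν δ s₁ s₂ → δ ⊑ ν
𝒩-pos⇒⊑ ν δ s₁ s₂ pos with count-pos⇒∃ _ (lists (length ν) (part ν 1)) pos
... | κ , p =
  let strips = proj₂ (T-∧⁻ (isDecr κ) p)
      δ⊑κ , κ⊑ν = T-∧⁻ (hstrip κ δ s₁) strips
  in ⊑-trans {δ} {κ} {ν} (hstrip⇒⊑ κ δ s₁ δ⊑κ) (hstrip⇒⊑ ν κ s₂ κ⊑ν)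

between-rows : ∀ {x y j} R κ → length κ ≡ suc (length R) → T (hstrip κ (y ∷ R) j) → κ ⊑ (x ∷ R) →
               κ ≡ y + j ∷ R
between-rows {x} {y} {j} R (κ₀ ∷ κ′) len strip κ⊑ = cong₂ _∷_ κ₀≡ κ′≡R
  where
    κ′≡R : κ′ ≡ R
    κ′≡R = ⊑-antisym {κ′} {R} (suc-injective len) (κ⊑ ∘ suc) (hstrip⇒⊑ (κ₀ ∷ κ′) (y ∷ R) j strip ∘ suc)
    y+j+R≡y+R+j : ∀ y j R → y + j + R ≡ y + R + j
    y+j+R≡y+R+j = solve-∀
    κ₀≡ : κ₀ ≡ y + j
    κ₀≡ = +-cancelʳ-≡ (sum R) κ₀ (y + j) (begin
      κ₀ + sum R       ≡⟨ cong (λ ρ → κ₀ + sum ρ) (sym κ′≡R) ⟩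
      κ₀ + sum κ′      ≡⟨ hstrip⇒sum (κ₀ ∷ κ′) (y ∷ R) j strip ⟩
      y + sum R + j    ≡⟨ sym (y+j+R≡y+R+j y j (sum R)) ⟩
      y + j + sum R    ∎)
      where open ≡-Reasoning

𝒩-row≤1 : ∀ x y R j s → 𝒩 (x ∷ R) (y ∷ R) j s ≤ 1
𝒩-row≤1 x y R j s = count≤1 _ (lists (suc (length R)) x) (lists-unique (suc (length R)) x)
  (λ κ∈ κ′∈ p p′ → trans (row κ∈ p) (sym (row κ′∈ p′)))
  where
    row : ∀ {κ} → κ ∈ lists (suc (length R)) x →
          T (isDecr κ ∧ hstrip κ (y ∷ R) j ∧ hstrip (x ∷ R) κ s) → κ ≡ y + j ∷ R
    row {κ} κ∈ p =
      let strips = proj₂ (T-∧⁻ (isDecr κ) p)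
          lower , upper = T-∧⁻ (hstrip κ (y ∷ R) j) strips
      in between-rows R κ (∈-lists⁻ _ _ κ∈) lower (hstrip⇒⊑ (x ∷ R) κ s upper)

𝒩-row-pos : ∀ {x y j} R → y + j ≤ x → T (isDecr (y ∷ R)) → 1 ≤ 𝒩 (x ∷ R) (y ∷ R) j (x ∸ (y + j))
𝒩-row-pos {x} {y} {j} R y+j≤x dec =
  count-pos _ (∈-lists⁺ x (y+j≤x ∷ All.map (λ r≤y → ≤-trans r≤y y≤x) (isDecr⇒All≤ R dec)))
    (T-∧⁺ (isDecr (y + j ∷ R)) dec′
      (T-∧⁺ (hstrip (y + j ∷ R) (y ∷ R) j) (hstrip-head R refl dec)
            (hstrip-head R (sym (m+[n∸m]≡n y+j≤x)) dec′)))
  where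
    y≤x = ≤-trans (m≤m+n y j) y+j≤x
    dec′ = isDecr-raise R (m≤m+n y j) dec

𝒩pred<𝒩⇒i≡0 : ∀ {a y i} R → T (isDecr (y ∷ R)) → i ≤ a →
  𝒩pred (a + y ∷ R) (y ∷ R) i (a ∸ i + 1) < 𝒩 (a + y ∷ R) (y ∷ R) i (a ∸ i) → i ≡ 0
𝒩pred<𝒩⇒i≡0         R dec z≤n  _ = refl
𝒩pred<𝒩⇒i≡0 {a} {y} {suc j} R dec 1+j≤a 𝒩< = ⊥-elim (<-irrefl refl (begin-strict
  1                                          ≤⟨ 𝒩-row-pos R y+j≤a+y dec ⟩
  𝒩 (a + y ∷ R) (y ∷ R) j (a + y ∸ (y + j))   ≡⟨ cong (𝒩 (a + y ∷ R) (y ∷ R) j) strip-size ⟩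
  𝒩 (a + y ∷ R) (y ∷ R) j (a ∸ suc j + 1)     <⟨ 𝒩< ⟩
  𝒩 (a + y ∷ R) (y ∷ R) (suc j) (a ∸ suc j)   ≤⟨ 𝒩-row≤1 (a + y) y R (suc j) (a ∸ suc j) ⟩
  1                                          ∎))
  where
    open ≤-Reasoning
    y+j≤a+y : y + j ≤ a + y
    y+j≤a+y = subst (y + j ≤_) (+-comm y a) (+-monoʳ-≤ y (<⇒≤ 1+j≤a))
    strip-size : a + y ∸ (y + j) ≡ a ∸ suc j + 1
    strip-size = begin-equality
      a + y ∸ (y + j)   ≡⟨ cong (_∸ (y + j)) (+-comm a y) ⟩
      y + a ∸ (y + j)   ≡⟨ [m+n]∸[m+o]≡n∸o y a j ⟩
      a ∸ j             ≡⟨ +-∸-assoc 1 1+j≤a ⟩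
      1 + (a ∸ suc j)   ≡⟨ +-comm 1 (a ∸ suc j) ⟩
      a ∸ suc j + 1     ∎

Ξ₁-Shape⇒i≡0×r≡1+twos : ∀ {a c r i R δ} → All (1 ≤_) R → T (isDecr (2 ∷ R)) → sum R ≡ c →
  i ≤ a → T (isPart δ) → sum δ ≡ c + 2 →
  𝒩pred (a + 2 ∷ R) δ i (a ∸ i + 1) < 𝒩 (a + 2 ∷ R) δ i (a ∸ i) →
  Ξ₁-Shape c r δ → i ≡ 0 × r ≡ suc (twos R)
Ξ₁-Shape⇒i≡0×r≡1+twos {a} {c} {r} {i} {R} pos-R dec sum-R i≤a part-δ sum-δ 𝒩< column =
  ⊥-elim (1+n≰n (begin
    suc (suc c)                    ≡⟨ +-comm 2 c ⟩
    c + 2                          ≡⟨ sym (length-replicate (c + 2)) ⟩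
    length (replicate (c + 2) 1)   ≤⟨ ⊑⇒length≤ {replicate (c + 2) 1} {a + 2 ∷ R} (isPart⇒positive _ part-δ) δ⊑ν ⟩
    suc (length R)                 ≤⟨ s≤s (length≤sum pos-R) ⟩
    suc (sum R)                    ≡⟨ cong suc sum-R ⟩
    suc c                          ∎))
  where
    open ≤-Reasoning
    δ⊑ν = 𝒩-pos⇒⊑ (a + 2 ∷ R) (replicate (c + 2) 1) i (a ∸ i) (≤-<-trans z≤n 𝒩<)
Ξ₁-Shape⇒i≡0×r≡1+twos {a} {c} {r} {i} {R} pos-R dec sum-R i≤a part-δ sum-δ 𝒩< (headTwo w r≡) =
  𝒩pred<𝒩⇒i≡0 R dec i≤a (subst (λ ρ → 𝒩pred ν (2 ∷ ρ) i (a ∸ i + 1) < 𝒩 ν (2 ∷ ρ) i (a ∸ i)) w≡R 𝒩<) ,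
  trans r≡ (cong (suc ∘ twos) w≡R)
  where
    ν = a + 2 ∷ R
    δ⊑ν = 𝒩-pos⇒⊑ ν (2 ∷ w) i (a ∸ i) (≤-<-trans z≤n 𝒩<)
    sum-w : sum w ≡ sum R
    sum-w = +-cancelˡ-≡ 2 (sum w) (sum R) (trans sum-δ (trans (+-comm c 2) (cong (λ k → 2 + k) (sym sum-R))))
    w≡R : w ≡ R
    w≡R = ⊑∧sum≡⇒≡ {w} {R} (All.tail (isPart⇒positive (2 ∷ w) part-δ)) pos-R (δ⊑ν ∘ suc) sum-w

sum-νₐ-tail : ∀ c s → 2 * suc s ≤ c + 2 → sum (replicate s 2 ++ replicate (c + 2 ∸ 2 * suc s) 1) ≡ c
sum-νₐ-tail c s 2S≤c+2 = +-cancelʳ-≡ 2 _ c (begin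
  sum (replicate s 2 ++ replicate q 1) + 2    ≡⟨ cong (_+ 2) (sum-++ (replicate s 2) (replicate q 1)) ⟩
  sum (replicate s 2) + sum (replicate q 1) + 2
    ≡⟨ cong₂ (λ x y → x + y + 2) (sum-replicate s 2) (sum-replicate q 1) ⟩
  s * 2 + q * 1 + 2                           ≡⟨ rearrange s q ⟩
  q + 2 * suc s                               ≡⟨ m∸n+n≡m 2S≤c+2 ⟩
  c + 2                                       ∎)
  where
    open ≡-Reasoning
    q = c + 2 ∸ 2 * suc s
    rearrange : ∀ s q → s * 2 + q * 1 + 2 ≡ q + 2 * suc s
    rearrange = solve-∀

ℐ⁻-νₐ⇒i≡0×r≡S : ∀ {a c S M δ i r} → M ≡ c + 2 → 1 ≤ c → 1 ≤ S → S ≤ (c + 2) / 2 →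
  ℐ⁻ (νₐ a c S) a 2 c M δ i r → i ≡ 0 × r ≡ S
ℐ⁻-νₐ⇒i≡0×r≡S {a} {c} {suc s} {δ = δ} refl 1≤c _ S≤ (((part-δ , sum-δ) , _) , i≤ , _ , 𝒩< , Ξ>0) =
  map₂ (λ r≡ → trans r≡ (cong suc (twos-2ᵖ1ᵠ≡p s q)))
    (Ξ₁-Shape⇒i≡0×r≡1+twos (2ᵖ1ᵠ-positive s q) (isDecr-2∷2ᵖ1ᵠ s q) (sum-νₐ-tail c s 2S≤c+2)
      (≤-trans i≤ (m/n≤m a 2)) part-δ sum-δ 𝒩< (Ξ₁-support δ 1≤c (part-δ , sum-δ) Ξ>0))
  where
    q = c + 2 ∸ 2 * suc s
    2S≤c+2 : 2 * suc s ≤ c + 2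
    2S≤c+2 = begin
      2 * suc s              ≤⟨ *-monoʳ-≤ 2 S≤ ⟩
      2 * ((c + 2) / 2)      ≡⟨ *-comm 2 ((c + 2) / 2) ⟩
      (c + 2) / 2 * 2        ≤⟨ m/n*n≤m (c + 2) 2 ⟩
      c + 2                  ∎
      where open ≤-Reasoning

[a+2+c]∸a≡c+2 : ∀ a c → a + 2 + c ∸ a ≡ c + 2
[a+2+c]∸a≡c+2 a c = trans (cong (_∸ a) (+-assoc a 2 c)) (trans (m+n∸m≡n a (2 + c)) (+-comm 2 c))

window⇒¬outside : ∀ {a c d S M} → M ≡ c + 2 → (a + S) ⊔ (M ∸ S) ≤ d → d ≤ a + M ∸ S →
  ¬ (d < (a + S) ⊔ (c + 2 ∸ S) ⊎ a + c + 2 ∸ S < d)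
window⇒¬outside refl low high (inj₁ d<) = <-irrefl refl (<-≤-trans d< low)
window⇒¬outside {a} {c} {d} {S} refl low high (inj₂ d>) =
  <-irrefl refl (<-≤-trans d> (subst (λ k → d ≤ k ∸ S) (sym (+-assoc a c 2)) high))

lemma5p9 : (a b c d e n M S : ℕ) → 2 ≤ a → b ≡ 2 → 1 ≤ c
  → a + b + c ≡ n → d + e ≡ n → e ≤ d → M ≡ n ∸ a
  → 1 ≤ S → S ≤ (c + 2) / 2
  → (d < (a + S) ⊔ (c + 2 ∸ S) ⊎ a + c + 2 ∸ S < d)
  → (δ : List ℕ) (i r : ℕ) → ¬ 𝒥⁻ d (νₐ a c S) a b c M δ i r
lemma5p9 a b c d e n M S _ refl 1≤c refl _ _ refl 1≤S S≤ d-outside δ i r (ℐ , low , high)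
  with ℐ⁻-νₐ⇒i≡0×r≡S ([a+2+c]∸a≡c+2 a c) 1≤c 1≤S S≤ ℐ
... | refl , refl = window⇒¬outside {a} {c} {d} {S} ([a+2+c]∸a≡c+2 a c) low high d-outside
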